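{- Let $P$ be a ranked simplicial poset of length $n$. Then \[\mu\big(\widehat{P^-\ast C_n}\big)=\sum_{r=0}^n(-1)^{r-1}W_r(P)\,r!,\] where $W_r(P)$ is the number of elements of rank $r$ in $P$.
   Context: A poset $P$ with minimum $\hat0_P$ is simplicial if every interval $[\hat0_P,x]$ is isomorphic to a Boolean algebra. $P^-=P\setminus\{\hat0_P\}$; $C_n$ is the chain $0<\dots<n-1$; the Rees product of ranked posets is $P\ast Q=\{(p,q): r_P(p)\ge r_Q(q)\}$ with $(p_1,q_1)\le(p_2,q_2)$ iff $p_1\le p_2$, $q_1\le q_2$, $r_P(p_2)-r_P(p_1)\ge r_Q(q_2)-r_Q(q_1)$. $\widehat X$ is $X$ with new minimum and maximum adjoined; $\mu(B)=\mu_B(\hat0_B,\hat1_B)$ is the Möbius invariant. -}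

module Defs where

open import Data.Nat as ℕ using (ℕ; zero; suc; _∸_)
open import Data.Integer as ℤ using (ℤ; +_; -1ℤ; 0ℤ; 1ℤ; _-_)
open import Data.List using (List; []; _∷_; filter; concatMap; map; upTo; length; foldr)
open import Data.List.Membership.Propositional using (_∈_)
open import Data.List.Relation.Unary.Unique.Propositional using (Unique)
open import Data.Fin.Subset using (Subset; _⊆_)
open import Data.Product using (Σ; Σ-syntax; ∃; ∃-syntax; _×_; _,_; proj₁; proj₂)
open import Data.Product.Properties using (≡-dec)
open import Relation.Nullary using (¬_; Dec; yes; no; _×-dec_; ¬?)
open import Relation.Binary using (Decidable; DecidableEquality)
open import Relation.Binary.PropositionalEquality using (_≡_)

record FinitePoset : Set₁ where
  field
    Carrier   : Set
    _≤_       : Carrier → Carrier → Set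
    ≤-refl    : ∀ x → x ≤ x
    ≤-trans   : ∀ {x y z} → x ≤ y → y ≤ z → x ≤ z
    ≤-antisym : ∀ {x y} → x ≤ y → y ≤ x → x ≡ y
    _≤?_      : Decidable _≤_
    _≟_       : DecidableEquality Carrier
    elems     : List Carrier
    complete  : ∀ x → x ∈ elems
    unique    : Unique elems

  _<_ : Carrier → Carrier → Set
  x < y = x ≤ y × ¬ (x ≡ y)

  _⋖_ : Carrier → Carrier → Set
  x ⋖ y = x < y × ¬ (Σ Carrier λ z → x < z × z < y)

module _ (P : FinitePoset) where
  open FinitePoset P

  IsMinimum : Carrier → Set
  IsMinimum b = ∀ x → b ≤ x

  Interval : Carrier → Carrier → Set
  Interval b x = Σ Carrier λ y → b ≤ y × y ≤ x

  IntervalIsoBoolean : Carrier → Carrier → ℕ → Set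
  IntervalIsoBoolean b x k =
    Σ (Interval b x → Subset k) λ f →
    Σ (Subset k → Interval b x) λ g →
      (∀ y → proj₁ (g (f y)) ≡ proj₁ y) ×
      (∀ s → f (g s) ≡ s) ×
      (∀ y z → (proj₁ y ≤ proj₁ z → f y ⊆ f z) × (f y ⊆ f z → proj₁ y ≤ proj₁ z))

  IsSimplicial : Carrier → Set
  IsSimplicial b = IsMinimum b × (∀ x → Σ ℕ λ k → IntervalIsoBoolean b x k)

  IsRankFunction : Carrier → (Carrier → ℕ) → Set
  IsRankFunction b rk = rk b ≡ 0 × (∀ x y → x ⋖ y → rk y ≡ suc (rk x))

  HasLength : (Carrier → ℕ) → ℕ → Set
  HasLength rk n = (∀ x → rk x ℕ.≤ n) × (Σ Carrier λ x → rk x ≡ n)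

  W : (Carrier → ℕ) → ℕ → ℕ
  W rk r = length (filter (λ x → rk x ℕ.≟ r) elems)

  -- P⁻ = P ∖ {b} with its own rank function
  -- r_{P⁻}(p) = rk p ∸ 1 (minimal elements of P⁻ have rank 0); C_n is the
  -- chain 0 < … < n-1 with rank r(i) = i.

  rkMinus : (Carrier → ℕ) → Carrier → ℕ
  rkMinus rk p = rk p ∸ 1

  ReesElems : Carrier → (Carrier → ℕ) → ℕ → List (Carrier × ℕ)
  ReesElems b rk n =
    filter (λ pi → ¬? (proj₁ pi ≟ b) ×-dec (proj₂ pi ℕ.≤? rkMinus rk (proj₁ pi)))
      (concatMap (λ p → map (λ i → (p , i)) (upTo n)) elems)

  ReesLe : (Carrier → ℕ) → Carrier × ℕ → Carrier × ℕ → Set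
  ReesLe rk (p₁ , i₁) (p₂ , i₂) =
    p₁ ≤ p₂ × i₁ ℕ.≤ i₂ ×
    (+ i₂ - + i₁) ℤ.≤ (+ rkMinus rk p₂ - + rkMinus rk p₁)

  ReesLe? : (rk : Carrier → ℕ) → Decidable (ReesLe rk)
  ReesLe? rk (p₁ , i₁) (p₂ , i₂) =
    (p₁ ≤? p₂) ×-dec (i₁ ℕ.≤? i₂) ×-dec
    ((+ i₂ - + i₁) ℤ.≤? (+ rkMinus rk p₂ - + rkMinus rk p₁))

  ReesLt : (Carrier → ℕ) → Carrier × ℕ → Carrier × ℕ → Set
  ReesLt rk a c = ReesLe rk a c × ¬ (a ≡ c)

  ReesLt? : (rk : Carrier → ℕ) → Decidable (ReesLt rk)
  ReesLt? rk a c = ReesLe? rk a c ×-dec ¬? (≡-dec _≟_ ℕ._≟_ a c)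

-- Möbius invariant μ(X̂) = μ_{X̂}(0̂,1̂) of a finite poset X (given by a
-- complete duplicate-free list xs and its decidable strict order) with a
-- new minimum 0̂ and maximum 1̂ adjoined, via the defining recursion
--   μ(0̂,0̂) = 1,   μ(0̂,y) = - Σ_{0̂ ≤ z < y} μ(0̂,z).
-- `fuel` bounds the recursion depth; fuel = length xs suffices since strict
-- chains in X have at most length xs elements.

sumℤ : List ℤ → ℤ
sumℤ = foldr ℤ._+_ 0ℤ

module _ {A : Set} (xs : List A) {_≺_ : A → A → Set} (_≺?_ : Decidable _≺_) where

  mobFrom0 : ℕ → A → ℤ
  mobFrom0 zero    x = 0ℤ
  mobFrom0 (suc k) x = ℤ.- (1ℤ ℤ.+ sumℤ (map (mobFrom0 k) (filter (λ z → z ≺? x) xs)))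

  mobiusHat : ℤ
  mobiusHat = ℤ.- (1ℤ ℤ.+ sumℤ (map (mobFrom0 (length xs)) xs))

-- (-1)^(r-1) as an integer (r = 0 gives (-1)^(-1) = -1)

signPred : ℕ → ℤ
signPred zero    = -1ℤ
signPred (suc r) = -1ℤ ℤ.^ r

-- Let P be simplicial with minimum b, rank function rk and length n, and put
-- σ(m) = (-1)^m m!.  Both sides of the corollary equal -(1 + Σ_{p ≠ b} σ(rk p)).
--
-- Right-hand side: Σ_r (-1)^(r-1) W_r r! regroups over elements as -Σ_p σ(rk p),
-- where b contributes σ(0) = 1 (alternating-rank-sum).
--
-- Left-hand side: P⁻ ∗ C_n consists of the pairs (p, i) with p ≠ b and i ≤ rk p - 1.
-- Summing the Möbius recursion over the fibre of p, the elements of the fibre of p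
-- above a fixed (q, j) number w(p, q) = rk p - rk q + 1 when q < p (rees-count), so the
-- fibre sums satisfy S(p) = -rk p - Σ_{b < q < p} w(p, q) S(q) (fibre-recursion).
-- By induction S(p) = σ(rk p) (fibre-value); the induction step is the identity
-- Σ_{q ≤ p} (rk p - rk q + 1) σ(rk q) = 1, true because [b, p] is the Boolean algebra
-- B_{rk p} (∑-lower-interval), where it becomes Σ_m C(k,m) (k - m + 1) (-1)^m m! = 1,
-- a telescoping sum of falling factorials (alternating-identity).  The recursion depth
-- used by mobiusHat is |P⁻ ∗ C_n|, which exceeds every rank (rank≤size).
module Submission where

open import Defs
open import Data.Nat using (ℕ; suc)
open import Data.Nat using (_!)
open import Data.Integer using (ℤ; +_; _*_)
open import Data.List using (map; upTo)
open import Relation.Binary.PropositionalEquality using (_≡_)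

open import Data.Nat as ℕ using (zero; _∸_; z≤n; s≤s)
import Data.Nat.Properties as ℕ
open import Data.Nat.Combinatorics using (_C_; nCk+nC[k+1]≡[n+1]C[k+1])
open import Data.Nat.Combinatorics.Base using (_P′_)
open import Data.Nat.Combinatorics.Specification using (P′-rec)
open import Data.Nat.Tactic.RingSolver renaming (solve-∀ to ℕ-solve-∀)
open import Data.Integer as ℤ using (0ℤ; 1ℤ; -1ℤ; _+_; -_; _-_; _^_)
import Data.Integer.Properties as ℤ
open import Data.Integer.Tactic.RingSolver using (solve-∀)
open import Data.List as List using (List; []; _∷_; _++_; filter; concatMap; length)
import Data.List.Properties as List
open import Data.List.Membership.Propositional using (_∈_)
open import Data.List.Membership.Propositional.Properties using (∈-map⁺; ∈-map⁻; ∈-++⁺ˡ; ∈-++⁺ʳ; ∈-upTo⁺; ∈-upTo⁻)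
open import Data.List.Relation.Unary.Any using (here; there)
import Data.List.Relation.Unary.All as All
open import Data.List.Relation.Unary.AllPairs using ([]; _∷_)
open import Data.List.Relation.Unary.Unique.Propositional using (Unique)
import Data.List.Relation.Unary.Unique.Propositional.Properties as Unique
import Data.Bool as Bool
open import Data.Vec using ([]; _∷_)
import Data.Vec as Vec
open import Data.Vec.Properties using (≡-dec)
open import Data.Fin.Subset using (Subset; inside; outside; ∣_∣; _⊆_; ⊥; ⊤)
open import Data.Fin.Subset.Properties using (⊆-antisym; drop-∷-⊆; out⊆; ⊆⊤; ⊥⊆; ∣⊥∣≡0; ∣⊤∣≡n; p⊆q⇒∣p∣≤∣q∣)
open import Data.Product using (Σ; _×_; _,_; proj₁; proj₂)
open import Data.Sum using (_⊎_; inj₁; inj₂)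
open import Relation.Nullary using (¬_; Dec; yes; no; _×-dec_; ¬?)
open import Relation.Binary using (DecidableEquality)
open import Relation.Binary.PropositionalEquality
  using (_≢_; refl; sym; trans; cong; cong₂; subst; subst₂; module ≡-Reasoning)
open import Function using (_∘_)
open import Data.Empty using (⊥-elim)

private
  variable
    A B : Set

-- Integer sums over lists and indicators

∑ : List A → (A → ℤ) → ℤ
∑ xs f = sumℤ (map f xs)

infixr 5 [_]·_
[_]·_ : Dec A → ℤ → ℤ
[ yes _ ]· v = v
[ no _ ]· v = 0ℤ

[]·-holds : (d : Dec A) → A → ∀ v → ([ d ]· v) ≡ v
[]·-holds (yes _) _ v = refl
[]·-holds (no ¬a) a v = ⊥-elim (¬a a)

[]·-fails : (d : Dec A) → ¬ A → ∀ v → ([ d ]· v) ≡ 0ℤ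
[]·-fails (yes a) ¬a v = ⊥-elim (¬a a)
[]·-fails (no _) _ v = refl

[]·-cong : (d : Dec A) {v w : ℤ} → (A → v ≡ w) → ([ d ]· v) ≡ ([ d ]· w)
[]·-cong (yes a) v≡w = v≡w a
[]·-cong (no _) _ = refl

[]·-*ˡ : (d : Dec A) (c v : ℤ) → ([ d ]· (c * v)) ≡ c * ([ d ]· v)
[]·-*ˡ (yes _) c v = refl
[]·-*ˡ (no _) c v = sym (ℤ.*-zeroʳ c)

[]·-as-* : (d : Dec A) (v : ℤ) → ([ d ]· v) ≡ ([ d ]· 1ℤ) * v
[]·-as-* (yes _) v = sym (ℤ.*-identityˡ v)
[]·-as-* (no _) v = refl

[]·-⇔ : (A → B) → (B → A) → (a : Dec A) (b : Dec B) (v : ℤ) → ([ a ]· v) ≡ ([ b ]· v)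
[]·-⇔ f g (yes a) b v = sym ([]·-holds b (f a) v)
[]·-⇔ f g (no ¬a) b v = sym ([]·-fails b (¬a ∘ g) v)

[]·-× : (a : Dec A) (b : Dec B) (v : ℤ) → ([ a ×-dec b ]· v) ≡ ([ a ]· [ b ]· v)
[]·-× (yes _) (yes _) v = refl
[]·-× (yes _) (no _) v = refl
[]·-× (no _) b v = refl

∑-++ : (xs ys : List A) (f : A → ℤ) → ∑ (xs ++ ys) f ≡ ∑ xs f + ∑ ys f
∑-++ [] ys f = sym (ℤ.+-identityˡ _)
∑-++ (x ∷ xs) ys f = trans (cong (λ t → f x + t) (∑-++ xs ys f)) (sym (ℤ.+-assoc (f x) _ _))

∑-cong : (xs : List A) {f g : A → ℤ} → (∀ {x} → x ∈ xs → f x ≡ g x) → ∑ xs f ≡ ∑ xs g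
∑-cong [] eq = refl
∑-cong (x ∷ xs) eq = cong₂ _+_ (eq (here refl)) (∑-cong xs (eq ∘ there))

∑-congP : (xs : List A) {f g : A → ℤ} → (∀ x → f x ≡ g x) → ∑ xs f ≡ ∑ xs g
∑-congP xs eq = ∑-cong xs (λ {x} _ → eq x)

∑-zero : (xs : List A) {f : A → ℤ} → (∀ {x} → x ∈ xs → f x ≡ 0ℤ) → ∑ xs f ≡ 0ℤ
∑-zero [] f≡0 = refl
∑-zero (x ∷ xs) f≡0 = cong₂ _+_ (f≡0 (here refl)) (∑-zero xs (f≡0 ∘ there))

∑-+ : (xs : List A) (f g : A → ℤ) → ∑ xs (λ x → f x + g x) ≡ ∑ xs f + ∑ xs g
∑-+ [] f g = refl
∑-+ (x ∷ xs) f g = trans (cong (λ t → f x + g x + t) (∑-+ xs f g)) (interchange (f x) (g x) _ _)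
  where
  interchange : ∀ a b c d → (a + b) + (c + d) ≡ (a + c) + (b + d)
  interchange = solve-∀

∑-*ˡ : (xs : List A) (c : ℤ) (f : A → ℤ) → ∑ xs (λ x → c * f x) ≡ c * ∑ xs f
∑-*ˡ [] c f = sym (ℤ.*-zeroʳ c)
∑-*ˡ (x ∷ xs) c f = trans (cong (λ t → c * f x + t) (∑-*ˡ xs c f)) (sym (ℤ.*-distribˡ-+ c (f x) _))

∑-*ʳ : (xs : List A) (f : A → ℤ) (c : ℤ) → ∑ xs (λ x → f x * c) ≡ ∑ xs f * c
∑-*ʳ xs f c = trans (∑-congP xs (λ x → ℤ.*-comm (f x) c)) (trans (∑-*ˡ xs c f) (ℤ.*-comm c _))

∑-neg : (xs : List A) (f : A → ℤ) → ∑ xs (λ x → - f x) ≡ - ∑ xs f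
∑-neg [] f = refl
∑-neg (x ∷ xs) f = trans (cong (λ t → - f x + t) (∑-neg xs f)) (sym (ℤ.neg-distrib-+ (f x) _))

∑-[]· : (xs : List A) (d : Dec B) (f : A → ℤ) → ∑ xs (λ x → [ d ]· f x) ≡ ([ d ]· ∑ xs f)
∑-[]· xs (yes _) f = refl
∑-[]· xs (no _) f = ∑-zero xs (λ _ → refl)

∑-filter : {P : A → Set} (P? : ∀ x → Dec (P x)) (xs : List A) (f : A → ℤ) →
  ∑ (filter P? xs) f ≡ ∑ xs (λ x → [ P? x ]· f x)
∑-filter P? [] f = refl
∑-filter P? (x ∷ xs) f with P? x
... | yes _ = cong (λ t → f x + t) (∑-filter P? xs f)
... | no _ = trans (∑-filter P? xs f) (sym (ℤ.+-identityˡ _))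

length-∑ : (xs : List A) → + length xs ≡ ∑ xs (λ _ → 1ℤ)
length-∑ [] = refl
length-∑ (x ∷ xs) = trans (ℤ.pos-+ 1 (length xs)) (cong (λ t → 1ℤ + t) (length-∑ xs))

∑-delta : (_≟_ : DecidableEquality A) (xs : List A) → Unique xs → ∀ {a} → a ∈ xs →
  (f : A → ℤ) → ∑ xs (λ x → [ x ≟ a ]· f x) ≡ f a
∑-delta _≟_ (x ∷ xs) (x∉xs ∷ _) (here refl) f =
  trans (cong₂ _+_ ([]·-holds (x ≟ x) refl (f x)) (∑-zero xs others-vanish)) (ℤ.+-identityʳ (f x))
  where
  others-vanish : ∀ {y} → y ∈ xs → ([ y ≟ x ]· f y) ≡ 0ℤ
  others-vanish y∈xs = []·-fails (_ ≟ x) (λ y≡x → All.lookup x∉xs y∈xs (sym y≡x)) _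
∑-delta _≟_ (x ∷ xs) (x∉xs ∷ u) {a} (there a∈xs) f =
  trans (cong₂ _+_ ([]·-fails (x ≟ a) x≢a (f x)) (∑-delta _≟_ xs u a∈xs f)) (ℤ.+-identityˡ (f a))
  where
  x≢a : ¬ x ≡ a
  x≢a refl = All.lookup x∉xs a∈xs refl

∑-≥-term : (xs : List A) (f : A → ℤ) → (∀ x → 0ℤ ℤ.≤ f x) → ∀ {a} → a ∈ xs → f a ℤ.≤ ∑ xs f
∑-≥-term (x ∷ xs) f f≥0 (here refl) =
  subst (ℤ._≤ f x + ∑ xs f) (ℤ.+-identityʳ (f x)) (ℤ.+-monoʳ-≤ (f x) (∑-≥0 xs))
  where
  ∑-≥0 : ∀ ys → 0ℤ ℤ.≤ ∑ ys f
  ∑-≥0 [] = ℤ.≤-refl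
  ∑-≥0 (y ∷ ys) = ℤ.+-mono-≤ (f≥0 y) (∑-≥0 ys)
∑-≥-term (x ∷ xs) f f≥0 (there a∈xs) =
  subst (ℤ._≤ f x + ∑ xs f) (ℤ.+-identityˡ _) (ℤ.+-mono-≤ (f≥0 x) (∑-≥-term xs f f≥0 a∈xs))

∑-map : (g : A → B) (xs : List A) (f : B → ℤ) → ∑ (map g xs) f ≡ ∑ xs (f ∘ g)
∑-map g [] f = refl
∑-map g (x ∷ xs) f = cong (λ t → f (g x) + t) (∑-map g xs f)

∑-concatMap : (g : A → List B) (xs : List A) (f : B → ℤ) → ∑ (concatMap g xs) f ≡ ∑ xs (λ x → ∑ (g x) f)
∑-concatMap g [] f = refl
∑-concatMap g (x ∷ xs) f = trans (∑-++ (g x) (concatMap g xs) f) (cong (λ t → ∑ (g x) f + t) (∑-concatMap g xs f))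

∑-swap : (xs : List A) (ys : List B) (f : A → B → ℤ) → ∑ xs (λ x → ∑ ys (f x)) ≡ ∑ ys (λ y → ∑ xs (λ x → f x y))
∑-swap [] ys f = sym (∑-zero ys (λ _ → refl))
∑-swap (x ∷ xs) ys f = trans (cong (λ t → ∑ ys (f x) + t) (∑-swap xs ys f)) (sym (∑-+ ys (f x) _))

∑-remove : (_≟_ : DecidableEquality A) (xs : List A) → Unique xs → ∀ {a} → a ∈ xs → (f : A → ℤ) →
  ∑ xs f ≡ f a + ∑ xs (λ x → [ ¬? (x ≟ a) ]· f x)
∑-remove _≟_ xs xs-unique {a} a∈xs f = begin
  ∑ xs f                                                        ≡⟨ ∑-congP xs (λ x → split (x ≟ a) (f x)) ⟩
  ∑ xs (λ x → ([ x ≟ a ]· f x) + ([ ¬? (x ≟ a) ]· f x))         ≡⟨ ∑-+ xs _ _ ⟩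
  ∑ xs (λ x → [ x ≟ a ]· f x) + ∑ xs (λ x → [ ¬? (x ≟ a) ]· f x) ≡⟨ cong (λ t → t + ∑ xs (λ x → [ ¬? (x ≟ a) ]· f x)) (∑-delta _≟_ xs xs-unique a∈xs f) ⟩
  f a + ∑ xs (λ x → [ ¬? (x ≟ a) ]· f x)                        ∎
  where
  open ≡-Reasoning
  split : ∀ {P : Set} (d : Dec P) v → v ≡ ([ d ]· v) + ([ ¬? d ]· v)
  split (yes _) v = sym (ℤ.+-identityʳ v)
  split (no _) v = sym (ℤ.+-identityˡ v)

∑-reindex : DecidableEquality A → DecidableEquality B →
  (xs : List A) → Unique xs → (∀ x → x ∈ xs) →
  (ys : List B) → Unique ys → (∀ y → y ∈ ys) →
  {P : A → Set} (P? : ∀ x → Dec (P x)) (g : B → A) (f : ∀ x → P x → B) →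
  (∀ y → P (g y)) → (∀ x p → g (f x p) ≡ x) → (∀ y y′ → g y ≡ g y′ → y ≡ y′) →
  (h : A → ℤ) → ∑ xs (λ x → [ P? x ]· h x) ≡ ∑ ys (h ∘ g)
∑-reindex _≟ᴬ_ _≟ᴮ_ xs xs-unique xs-complete ys ys-unique ys-complete {P} P? g f g∈P gf≡id g-injective h =
  begin
    ∑ xs (λ x → [ P? x ]· h x)                      ≡⟨ ∑-congP xs fibre ⟨
    ∑ xs (λ x → ∑ ys (λ y → [ x ≟ᴬ g y ]· h x))     ≡⟨ ∑-swap xs ys _ ⟩
    ∑ ys (λ y → ∑ xs (λ x → [ x ≟ᴬ g y ]· h x))     ≡⟨ ∑-congP ys (λ y → ∑-delta _≟ᴬ_ xs xs-unique (xs-complete (g y)) h) ⟩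
    ∑ ys (h ∘ g)                                    ∎
  where
  open ≡-Reasoning
  -- the fibre of g over x is {f x p} if P x holds and empty otherwise
  fibre : ∀ x → ∑ ys (λ y → [ x ≟ᴬ g y ]· h x) ≡ ([ P? x ]· h x)
  fibre x with P? x
  ... | yes p = trans (∑-congP ys (λ y → []·-⇔ (to y) (from y) (x ≟ᴬ g y) (y ≟ᴮ f x p) (h x)))
                      (∑-delta _≟ᴮ_ ys ys-unique (ys-complete (f x p)) (λ _ → h x))
    where
    to : ∀ y → x ≡ g y → y ≡ f x p
    to y x≡gy = g-injective y (f x p) (trans (sym x≡gy) (sym (gf≡id x p)))
    from : ∀ y → y ≡ f x p → x ≡ g y
    from y refl = sym (gf≡id x p)
  ... | no ¬p = ∑-zero ys (λ {y} _ → []·-fails (x ≟ᴬ g y) (λ x≡gy → ¬p (subst P (sym x≡gy) (g∈P y))) (h x))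

∑-upTo-head : ∀ N (f : ℕ → ℤ) → ∑ (upTo (suc N)) f ≡ f 0 + ∑ (upTo N) (f ∘ suc)
∑-upTo-head N f = cong (λ t → f 0 + t) (trans (cong (λ l → ∑ l f) (sym (List.map-upTo suc N))) (∑-map suc (upTo N) f))

∑-upTo-last : ∀ N (f : ℕ → ℤ) → ∑ (upTo (suc N)) f ≡ ∑ (upTo N) f + f N
∑-upTo-last N f = begin
  ∑ (upTo (suc N)) f              ≡⟨ cong (λ l → ∑ l f) (sym (List.upTo-∷ʳ N)) ⟩
  ∑ (upTo N List.∷ʳ N) f          ≡⟨ ∑-++ (upTo N) (N ∷ []) f ⟩
  ∑ (upTo N) f + (f N + 0ℤ)       ≡⟨ cong (λ t → ∑ (upTo N) f + t) (ℤ.+-identityʳ (f N)) ⟩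
  ∑ (upTo N) f + f N              ∎
  where open ≡-Reasoning

-- The Boolean algebra B_k and an alternating identity over it

subsets : (k : ℕ) → List (Subset k)
subsets zero = [] ∷ []
subsets (suc k) = map (outside ∷_) (subsets k) ++ map (inside ∷_) (subsets k)

subsets-complete : ∀ {k} (S : Subset k) → S ∈ subsets k
subsets-complete [] = here refl
subsets-complete {suc k} (outside ∷ S) = ∈-++⁺ˡ (∈-map⁺ (outside ∷_) (subsets-complete S))
subsets-complete {suc k} (inside ∷ S) = ∈-++⁺ʳ (map (outside ∷_) (subsets k)) (∈-map⁺ (inside ∷_) (subsets-complete S))

subsets-unique : ∀ k → Unique (subsets k)
subsets-unique zero = All.[] ∷ []
subsets-unique (suc k) =
  Unique.++⁺ (Unique.map⁺ (cong Vec.tail) (subsets-unique k)) (Unique.map⁺ (cong Vec.tail) (subsets-unique k)) disjoint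
  where
  disjoint : ∀ {S} → ¬ (S ∈ map (outside ∷_) (subsets k) × S ∈ map (inside ∷_) (subsets k))
  disjoint (∈outside , ∈inside) with ∈-map⁻ (outside ∷_) ∈outside | ∈-map⁻ (inside ∷_) ∈inside
  ... | _ , _ , refl | _ , _ , ()

∑-subsets-by-size : ∀ k N → k ℕ.< N → (h : ℕ → ℤ) →
  ∑ (subsets k) (h ∘ ∣_∣) ≡ ∑ (upTo N) (λ m → + (k C m) * h m)
∑-subsets-by-size zero (suc N) _ h = begin
  h 0 + 0ℤ                                      ≡⟨ cong₂ _+_ (sym (ℤ.*-identityˡ (h 0))) (sym (∑-zero (upTo N) (λ {m} _ → ℤ.*-zeroˡ (h (suc m))))) ⟩
  1ℤ * h 0 + ∑ (upTo N) (λ m → 0ℤ * h (suc m))  ≡⟨ ∑-upTo-head N (λ m → + (0 C m) * h m) ⟨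
  ∑ (upTo (suc N)) (λ m → + (0 C m) * h m)      ∎
  where open ≡-Reasoning
∑-subsets-by-size (suc k) (suc N) (s≤s k<N) h = begin
  ∑ (subsets (suc k)) (h ∘ ∣_∣)
    ≡⟨ ∑-++ (map (outside ∷_) (subsets k)) _ (h ∘ ∣_∣) ⟩
  ∑ (map (outside ∷_) (subsets k)) (h ∘ ∣_∣) + ∑ (map (inside ∷_) (subsets k)) (h ∘ ∣_∣)
    ≡⟨ cong₂ _+_ (∑-map (outside ∷_) (subsets k) (h ∘ ∣_∣)) (∑-map (inside ∷_) (subsets k) (h ∘ ∣_∣)) ⟩
  ∑ (subsets k) (h ∘ ∣_∣) + ∑ (subsets k) (h ∘ suc ∘ ∣_∣)
    ≡⟨ cong₂ _+_ (∑-subsets-by-size k (suc N) (ℕ.m≤n⇒m≤1+n k<N) h) (∑-subsets-by-size k N k<N (h ∘ suc)) ⟩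
  ∑ (upTo (suc N)) (λ m → + (k C m) * h m) + ∑ (upTo N) (λ m → + (k C m) * h (suc m))
    ≡⟨ cong (λ t → t + ∑ (upTo N) (λ m → + (k C m) * h (suc m))) (∑-upTo-head N (λ m → + (k C m) * h m)) ⟩
  (1ℤ * h 0 + ∑ (upTo N) (λ m → + (k C suc m) * h (suc m))) + ∑ (upTo N) (λ m → + (k C m) * h (suc m))
    ≡⟨ regroup (h 0) _ _ ⟩
  h 0 + (∑ (upTo N) (λ m → + (k C m) * h (suc m)) + ∑ (upTo N) (λ m → + (k C suc m) * h (suc m)))
    ≡⟨ cong (λ t → h 0 + t) (sym (∑-+ (upTo N) _ _)) ⟩
  h 0 + ∑ (upTo N) (λ m → + (k C m) * h (suc m) + + (k C suc m) * h (suc m))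
    ≡⟨ cong₂ _+_ (sym (ℤ.*-identityˡ (h 0))) (∑-congP (upTo N) pascal) ⟩
  1ℤ * h 0 + ∑ (upTo N) (λ m → + (suc k C suc m) * h (suc m))
    ≡⟨ ∑-upTo-head N (λ m → + (suc k C m) * h m) ⟨
  ∑ (upTo (suc N)) (λ m → + (suc k C m) * h m)
    ∎
  where
  open ≡-Reasoning
  regroup : ∀ a b c → (1ℤ * a + b) + c ≡ a + (c + b)
  regroup = solve-∀
  pascal : ∀ m → + (k C m) * h (suc m) + + (k C suc m) * h (suc m) ≡ + (suc k C suc m) * h (suc m)
  pascal m = begin
    + (k C m) * h (suc m) + + (k C suc m) * h (suc m)  ≡⟨ ℤ.*-distribʳ-+ (h (suc m)) (+ (k C m)) (+ (k C suc m)) ⟨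
    (+ (k C m) + + (k C suc m)) * h (suc m)            ≡⟨ cong (λ c → c * h (suc m)) (ℤ.pos-+ (k C m) (k C suc m)) ⟨
    + (k C m ℕ.+ k C suc m) * h (suc m)                ≡⟨ cong (λ c → + c * h (suc m)) (nCk+nC[k+1]≡[n+1]C[k+1] k m) ⟩
    + (suc k C suc m) * h (suc m)                      ∎

⊆-size-≡ : ∀ {k} {S T : Subset k} → S ⊆ T → ∣ S ∣ ≡ ∣ T ∣ → S ≡ T
⊆-size-≡ {S = []} {[]} _ _ = refl
⊆-size-≡ {S = inside ∷ S} {inside ∷ T} S⊆T eq = cong (inside ∷_) (⊆-size-≡ (drop-∷-⊆ S⊆T) (ℕ.suc-injective eq))
⊆-size-≡ {S = outside ∷ S} {outside ∷ T} S⊆T eq = cong (outside ∷_) (⊆-size-≡ (drop-∷-⊆ S⊆T) eq)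
⊆-size-≡ {S = inside ∷ S} {outside ∷ T} S⊆T eq with () ← S⊆T Vec.here
⊆-size-≡ {S = outside ∷ S} {inside ∷ T} S⊆T eq = ⊥-elim (ℕ.<⇒≢ (s≤s (p⊆q⇒∣p∣≤∣q∣ (drop-∷-⊆ S⊆T))) eq)

⊊⇒size< : ∀ {k} {S T : Subset k} → S ⊆ T → S ≢ T → ∣ S ∣ ℕ.< ∣ T ∣
⊊⇒size< S⊆T S≢T with ℕ.m≤n⇒m<n∨m≡n (p⊆q⇒∣p∣≤∣q∣ S⊆T)
... | inj₁ lt = lt
... | inj₂ eq = ⊥-elim (S≢T (⊆-size-≡ S⊆T eq))

dropFirst : ∀ {k} → Subset k → Subset k
dropFirst [] = []
dropFirst (inside ∷ S) = outside ∷ S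
dropFirst (outside ∷ S) = outside ∷ dropFirst S

dropFirst-⊆ : ∀ {k} (S : Subset k) → dropFirst S ⊆ S
dropFirst-⊆ [] x∈ = x∈
dropFirst-⊆ (inside ∷ S) = out⊆ (λ x∈ → x∈)
dropFirst-⊆ (outside ∷ S) = out⊆ (dropFirst-⊆ S)

dropFirst-size : ∀ {k} (S : Subset k) {m} → ∣ S ∣ ≡ suc m → ∣ dropFirst S ∣ ≡ m
dropFirst-size (inside ∷ S) eq = ℕ.suc-injective eq
dropFirst-size (outside ∷ S) eq = dropFirst-size S eq

squeeze : ∀ {k} {S′ T S : Subset k} → S′ ⊆ T → T ⊆ S → ∣ S ∣ ≡ suc ∣ S′ ∣ → T ≡ S′ ⊎ T ≡ S
squeeze {S′ = S′} {T} {S} S′⊆T T⊆S size-S with ℕ.m≤n⇒m<n∨m≡n (subst (∣ T ∣ ℕ.≤_) size-S (p⊆q⇒∣p∣≤∣q∣ T⊆S))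
... | inj₂ eq = inj₂ (⊆-size-≡ T⊆S (trans eq (sym size-S)))
... | inj₁ (s≤s T≤S′) = inj₁ (sym (⊆-size-≡ S′⊆T (ℕ.≤-antisym (p⊆q⇒∣p∣≤∣q∣ S′⊆T) T≤S′)))

pos-∸ : ∀ {m n} → n ℕ.≤ m → + m - + n ≡ + (m ∸ n)
pos-∸ {m} {n} n≤m = trans (ℤ.m-n≡m⊖n m n) (ℤ.⊖-≥ n≤m)

-- σ m = (-1)^m m!, the Möbius value attached to a rank-m element.
σ : ℕ → ℤ
σ m = -1ℤ ^ m * + (m !)

P′-vanishes : ∀ {k m} → k ℕ.< m → k P′ m ≡ 0
P′-vanishes {k} {suc m} (s≤s k≤m) with ℕ.m≤n⇒m<n∨m≡n k≤m
... | inj₁ k<m = trans (cong ((k ∸ m) ℕ.*_) (P′-vanishes k<m)) (ℕ.*-zeroʳ (k ∸ m))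
... | inj₂ refl = cong (ℕ._* (k P′ k)) (ℕ.n∸n≡0 k)

P′-pascal : ∀ k m → suc k P′ suc m ≡ suc m ℕ.* (k P′ m) ℕ.+ k P′ suc m
P′-pascal k m with m ℕ.≤? k
... | yes m≤k = P′-rec (s≤s m≤k)
... | no m≰k = begin
  suc k P′ suc m                     ≡⟨ P′-vanishes (s≤s k<m) ⟩
  0                                  ≡⟨ trans (ℕ.+-identityʳ _) (ℕ.*-zeroʳ (suc m)) ⟨
  suc m ℕ.* 0 ℕ.+ 0                  ≡⟨ cong₂ (λ x y → suc m ℕ.* x ℕ.+ y) (P′-vanishes k<m) (P′-vanishes (ℕ.m<n⇒m<1+n k<m)) ⟨
  suc m ℕ.* (k P′ m) ℕ.+ k P′ suc m  ∎
  where
  open ≡-Reasoning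
  k<m : k ℕ.< m
  k<m = ℕ.≰⇒> m≰k

C*!≡P′ : ∀ k m → (k C m) ℕ.* m ! ≡ k P′ m
C*!≡P′ k zero = refl
C*!≡P′ zero (suc m) = sym (cong (ℕ._* (0 P′ m)) (ℕ.0∸n≡0 m))
C*!≡P′ (suc k) (suc m) = begin
  (suc k C suc m) ℕ.* suc m !                              ≡⟨ cong (ℕ._* suc m !) (nCk+nC[k+1]≡[n+1]C[k+1] k m) ⟨
  ((k C m) ℕ.+ (k C suc m)) ℕ.* (suc m ℕ.* m !)            ≡⟨ distribute (k C m) (k C suc m) m (m !) ⟩
  suc m ℕ.* ((k C m) ℕ.* m !) ℕ.+ (k C suc m) ℕ.* suc m !  ≡⟨ cong₂ (λ x y → suc m ℕ.* x ℕ.+ y) (C*!≡P′ k m) (C*!≡P′ k (suc m)) ⟩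
  suc m ℕ.* (k P′ m) ℕ.+ k P′ suc m                        ≡⟨ P′-pascal k m ⟨
  suc k P′ suc m                                           ∎
  where
  open ≡-Reasoning
  distribute : ∀ a b m f → (a ℕ.+ b) ℕ.* (suc m ℕ.* f) ≡ suc m ℕ.* (a ℕ.* f) ℕ.+ b ℕ.* (suc m ℕ.* f)
  distribute = ℕ-solve-∀

telescope : ∀ N (a : ℕ → ℤ) → ∑ (upTo N) (λ m → -1ℤ ^ m * (a m + a (suc m))) ≡ a 0 - -1ℤ ^ N * a N
telescope zero a = cancel (a 0)
  where
  cancel : ∀ x → 0ℤ ≡ x - 1ℤ * x
  cancel = solve-∀
telescope (suc N) a = begin
  ∑ (upTo (suc N)) (λ m → -1ℤ ^ m * (a m + a (suc m)))                 ≡⟨ ∑-upTo-last N _ ⟩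
  ∑ (upTo N) (λ m → -1ℤ ^ m * (a m + a (suc m))) + -1ℤ ^ N * (a N + a (suc N))
                                                                       ≡⟨ cong (λ t → t + -1ℤ ^ N * (a N + a (suc N))) (telescope N a) ⟩
  a 0 - -1ℤ ^ N * a N + -1ℤ ^ N * (a N + a (suc N))                    ≡⟨ collapse (a 0) (-1ℤ ^ N) (a N) (a (suc N)) ⟩
  a 0 - -1ℤ ^ suc N * a (suc N)                                        ∎
  where
  open ≡-Reasoning
  collapse : ∀ x s y z → x - s * y + s * (y + z) ≡ x - (-1ℤ * s) * z
  collapse = solve-∀

-- The key identity on B_k: Σ_{S ⊆ [k]} (k - |S| + 1) (-1)^|S| |S|! = 1.
-- Grouping by size, the m-th term is (-1)^m (k P′ m + k P′ (m+1)), which telescopes.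
alternating-identity : ∀ k → ∑ (subsets k) (λ S → (+ k - + ∣ S ∣ + 1ℤ) * σ ∣ S ∣) ≡ 1ℤ
alternating-identity k = begin
  ∑ (subsets k) (λ S → (+ k - + ∣ S ∣ + 1ℤ) * σ ∣ S ∣)                ≡⟨ ∑-subsets-by-size k (suc k) (ℕ.n<1+n k) (λ m → (+ k - + m + 1ℤ) * σ m) ⟩
  ∑ (upTo (suc k)) (λ m → + (k C m) * ((+ k - + m + 1ℤ) * σ m))      ≡⟨ ∑-cong (upTo (suc k)) (λ m∈ → term (∈-upTo⁻ m∈)) ⟩
  ∑ (upTo (suc k)) (λ m → -1ℤ ^ m * (+ (k P′ m) + + (k P′ suc m)))   ≡⟨ telescope (suc k) (λ m → + (k P′ m)) ⟩
  1ℤ - -1ℤ ^ suc k * + (k P′ suc k)                                  ≡⟨ cong (λ x → 1ℤ - -1ℤ ^ suc k * + x) (P′-vanishes (ℕ.n<1+n k)) ⟩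
  1ℤ - -1ℤ ^ suc k * 0ℤ                                              ≡⟨ cong (λ x → 1ℤ - x) (ℤ.*-zeroʳ (-1ℤ ^ suc k)) ⟩
  1ℤ                                                                 ∎
  where
  open ≡-Reasoning
  regroup : ∀ c d s f → c * ((d + 1ℤ) * (s * f)) ≡ s * (c * f + d * (c * f))
  regroup = solve-∀
  term : ∀ {m} → m ℕ.< suc k → + (k C m) * ((+ k - + m + 1ℤ) * σ m) ≡ -1ℤ ^ m * (+ (k P′ m) + + (k P′ suc m))
  term {m} (s≤s m≤k) = begin
    + (k C m) * ((+ k - + m + 1ℤ) * (-1ℤ ^ m * + (m !)))
      ≡⟨ regroup (+ (k C m)) (+ k - + m) (-1ℤ ^ m) (+ (m !)) ⟩
    -1ℤ ^ m * (+ (k C m) * + (m !) + (+ k - + m) * (+ (k C m) * + (m !)))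
      ≡⟨ cong₂ (λ x d → -1ℤ ^ m * (x + d * x)) (trans (sym (ℤ.pos-* (k C m) (m !))) (cong +_ (C*!≡P′ k m))) (pos-∸ m≤k) ⟩
    -1ℤ ^ m * (+ (k P′ m) + + (k ∸ m) * + (k P′ m))
      ≡⟨ cong (λ x → -1ℤ ^ m * (+ (k P′ m) + x)) (ℤ.pos-* (k ∸ m) (k P′ m)) ⟨
    -1ℤ ^ m * (+ (k P′ m) + + (k P′ suc m))
      ∎

-- Ranks in a simplicial poset

module SimplicialRanks (P : FinitePoset) (b : FinitePoset.Carrier P) (simplicial : IsSimplicial P b)
                       (rk : FinitePoset.Carrier P → ℕ) (rank : IsRankFunction P b rk) where
  open FinitePoset P

  b-min : IsMinimum P b
  b-min = proj₁ simplicial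

  module LowerInterval (p : Carrier) where
    k : ℕ
    k = proj₁ (proj₂ simplicial p)

    private
      iso : IntervalIsoBoolean P b p k
      iso = proj₂ (proj₂ simplicial p)

    toSubset : Interval P b p → Subset k
    toSubset = proj₁ iso

    fromSubset : Subset k → Interval P b p
    fromSubset = proj₁ (proj₂ iso)

    from∘to : ∀ y → proj₁ (fromSubset (toSubset y)) ≡ proj₁ y
    from∘to = proj₁ (proj₂ (proj₂ iso))

    to∘from : ∀ S → toSubset (fromSubset S) ≡ S
    to∘from = proj₁ (proj₂ (proj₂ (proj₂ iso)))

    to-mono : ∀ y z → proj₁ y ≤ proj₁ z → toSubset y ⊆ toSubset z
    to-mono y z = proj₁ (proj₂ (proj₂ (proj₂ (proj₂ iso))) y z)

    to-reflect : ∀ y z → toSubset y ⊆ toSubset z → proj₁ y ≤ proj₁ z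
    to-reflect y z = proj₂ (proj₂ (proj₂ (proj₂ (proj₂ iso))) y z)

    ↑ : ∀ {q} → q ≤ p → Interval P b p
    ↑ {q} q≤p = q , b-min q , q≤p

    to-resp : ∀ y z → proj₁ y ≡ proj₁ z → toSubset y ≡ toSubset z
    to-resp y z y≡z = ⊆-antisym (to-mono y z (subst (proj₁ y ≤_) y≡z (≤-refl _)))
                                (to-mono z y (subst (_≤ proj₁ y) y≡z (≤-refl _)))

    to-injective : ∀ y z → toSubset y ≡ toSubset z → proj₁ y ≡ proj₁ z
    to-injective y z eq = trans (sym (from∘to y)) (trans (cong (proj₁ ∘ fromSubset) eq) (from∘to z))

    -- The rank of an element of [b, p] is the size of the corresponding subset:
    -- removing one point of S gives an element covered by the one of S.
    rank-of-size : ∀ m y → ∣ toSubset y ∣ ≡ m → rk (proj₁ y) ≡ m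
    rank-of-size zero y size≡0 = trans (cong rk y≡b) (proj₁ rank)
      where
      S≡⊥ : toSubset y ≡ ⊥
      S≡⊥ = sym (⊆-size-≡ ⊥⊆ (trans (∣⊥∣≡0 k) (sym size≡0)))
      y≡b : proj₁ y ≡ b
      y≡b = to-injective y (↑ (b-min p))
              (⊆-antisym (subst (_⊆ toSubset (↑ (b-min p))) (sym S≡⊥) ⊥⊆) (to-mono (↑ (b-min p)) y (b-min (proj₁ y))))
    rank-of-size (suc m) y size≡1+m =
      trans (proj₂ rank (proj₁ y′) (proj₁ y) y′⋖y) (cong suc (rank-of-size m y′ size-y′))
      where
      S : Subset k
      S = toSubset y
      y′ : Interval P b p
      y′ = fromSubset (dropFirst S)
      size-y′ : ∣ toSubset y′ ∣ ≡ m
      size-y′ = trans (cong ∣_∣ (to∘from (dropFirst S))) (dropFirst-size S size≡1+m)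
      size-y : ∣ S ∣ ≡ suc ∣ toSubset y′ ∣
      size-y = trans size≡1+m (cong suc (sym size-y′))
      y′⊆y : toSubset y′ ⊆ S
      y′⊆y = subst (_⊆ S) (sym (to∘from _)) (dropFirst-⊆ S)
      y′≢y : ¬ proj₁ y′ ≡ proj₁ y
      y′≢y eq = ℕ.<-irrefl (trans (cong ∣_∣ (to-resp y′ y eq)) size-y) (ℕ.n<1+n _)
      nothing-between : ¬ (Σ Carrier λ z → proj₁ y′ < z × z < proj₁ y)
      nothing-between (z , (y′≤z , y′≢z) , (z≤y , z≢y))
        with squeeze (to-mono y′ z′ y′≤z) (to-mono z′ y z≤y) size-y
        where
        z′ : Interval P b p
        z′ = z , ≤-trans (proj₁ (proj₂ y′)) y′≤z , ≤-trans z≤y (proj₂ (proj₂ y))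
      ... | inj₁ z≡y′ = y′≢z (sym (to-injective _ y′ z≡y′))
      ... | inj₂ z≡y = z≢y (to-injective _ y z≡y)
      y′⋖y : proj₁ y′ ⋖ proj₁ y
      y′⋖y = (to-reflect y′ y y′⊆y , y′≢y) , nothing-between

    rank-is-size : ∀ y → rk (proj₁ y) ≡ ∣ toSubset y ∣
    rank-is-size y = rank-of-size _ y refl

    -- p itself corresponds to the full set, so [b, p] ≅ B_{rk p}.
    rank-top : rk p ≡ k
    rank-top = trans (rank-is-size (↑ (≤-refl p))) (trans (cong ∣_∣ p↦⊤) (∣⊤∣≡n k))
      where
      p↦⊤ : toSubset (↑ (≤-refl p)) ≡ ⊤
      p↦⊤ = ⊆-antisym ⊆⊤ (subst (_⊆ toSubset (↑ (≤-refl p))) (to∘from ⊤)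
                               (to-mono (fromSubset ⊤) (↑ (≤-refl p)) (proj₂ (proj₂ (fromSubset ⊤)))))

  rank-strict : ∀ {q p} → q ≤ p → ¬ q ≡ p → rk q ℕ.< rk p
  rank-strict {q} {p} q≤p q≢p =
    subst₂ ℕ._<_ (sym (rank-is-size (↑ q≤p))) (sym (rank-is-size (↑ (≤-refl p))))
      (⊊⇒size< (to-mono (↑ q≤p) (↑ (≤-refl p)) q≤p) (q≢p ∘ to-injective (↑ q≤p) (↑ (≤-refl p))))
    where open LowerInterval p

  rank-pos : ∀ {p} → ¬ p ≡ b → 1 ℕ.≤ rk p
  rank-pos {p} p≢b = subst (λ r → suc r ℕ.≤ rk p) (proj₁ rank) (rank-strict (b-min p) (p≢b ∘ sym))

  ∑-lower-interval : ∀ p (h : ℕ → ℤ) → ∑ elems (λ q → [ q ≤? p ]· h (rk q)) ≡ ∑ (subsets (LowerInterval.k p)) (h ∘ ∣_∣)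
  ∑-lower-interval p h = begin
    ∑ elems (λ q → [ q ≤? p ]· h (rk q))
      ≡⟨ ∑-reindex _≟_ (≡-dec Bool._≟_) elems unique complete (subsets k) (subsets-unique k) subsets-complete
           (_≤? p) (proj₁ ∘ fromSubset) (λ q q≤p → toSubset (↑ q≤p)) (proj₂ ∘ proj₂ ∘ fromSubset)
           (λ q q≤p → from∘to (↑ q≤p)) from-injective (h ∘ rk) ⟩
    ∑ (subsets k) (h ∘ rk ∘ proj₁ ∘ fromSubset)
      ≡⟨ ∑-congP (subsets k) (λ S → cong h (trans (rank-is-size (fromSubset S)) (cong ∣_∣ (to∘from S)))) ⟩
    ∑ (subsets k) (h ∘ ∣_∣)
      ∎
    where
    open ≡-Reasoning
    open LowerInterval p
    from-injective : ∀ S T → proj₁ (fromSubset S) ≡ proj₁ (fromSubset T) → S ≡ T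
    from-injective S T eq = trans (sym (to∘from S)) (trans (to-resp _ _ eq) (to∘from T))

  interval-identity : ∀ p → ∑ elems (λ q → [ q ≤? p ]· ((+ rk p - + rk q + 1ℤ) * σ (rk q))) ≡ 1ℤ
  interval-identity p = trans (∑-lower-interval p (λ m → (+ rk p - + m + 1ℤ) * σ m))
    (subst (λ r → ∑ (subsets k) (λ S → (+ r - + ∣ S ∣ + 1ℤ) * σ ∣ S ∣) ≡ 1ℤ) (sym rank-top) (alternating-identity k))
    where open LowerInterval p using (k; rank-top)

count-window : ∀ N a c → ∑ (upTo N) (λ i → [ a ℕ.≤? i ×-dec i ℕ.≤? c ]· 1ℤ) ≡ + ((suc c ℕ.⊓ N) ∸ a)
count-window zero a c = cong +_ (sym (trans (cong (_∸ a) (ℕ.⊓-zeroʳ (suc c))) (ℕ.0∸n≡0 a)))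
count-window (suc N) a c =
  trans (∑-upTo-last N _) (trans (cong (λ t → t + ([ a ℕ.≤? N ×-dec N ℕ.≤? c ]· 1ℤ)) (count-window N a c)) (new-point (a ℕ.≤? N) (N ℕ.≤? c)))
  where
  new-point : (a≤N? : Dec (a ℕ.≤ N)) (N≤c? : Dec (N ℕ.≤ c)) →
    + ((suc c ℕ.⊓ N) ∸ a) + ([ a≤N? ×-dec N≤c? ]· 1ℤ) ≡ + ((suc c ℕ.⊓ suc N) ∸ a)
  new-point (yes a≤N) (yes N≤c)
    rewrite ℕ.m≥n⇒m⊓n≡n (ℕ.m≤n⇒m≤1+n N≤c) | ℕ.m≥n⇒m⊓n≡n (s≤s N≤c)
    = trans (sym (ℤ.pos-+ (N ∸ a) 1)) (cong +_ (trans (ℕ.+-comm (N ∸ a) 1) (sym (ℕ.+-∸-assoc 1 a≤N))))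
  new-point (no a≰N) (yes N≤c)
    rewrite ℕ.m≥n⇒m⊓n≡n (ℕ.m≤n⇒m≤1+n N≤c) | ℕ.m≥n⇒m⊓n≡n (s≤s N≤c)
          | ℕ.m≤n⇒m∸n≡0 (ℕ.<⇒≤ (ℕ.≰⇒> a≰N)) | ℕ.m≤n⇒m∸n≡0 (ℕ.≰⇒> a≰N) = refl
  new-point a≤N? (no N≰c)
    rewrite ℕ.m≤n⇒m⊓n≡m (ℕ.≰⇒> N≰c) | ℕ.m≤n⇒m⊓n≡m (ℕ.m≤n⇒m≤1+n (ℕ.≰⇒> N≰c))
    = trans (cong (λ t → + (suc c ∸ a) + t) ([]·-fails (a≤N? ×-dec no N≰c) (N≰c ∘ proj₂) 1ℤ)) (ℤ.+-identityʳ _)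

count-window-< : ∀ N a c → c ℕ.< N → ∑ (upTo N) (λ i → [ a ℕ.≤? i ×-dec i ℕ.≤? c ]· 1ℤ) ≡ + (suc c ∸ a)
count-window-< N a c c<N = trans (count-window N a c) (cong (λ x → + (x ∸ a)) (ℕ.m≤n⇒m⊓n≡m c<N))

count-below : ∀ N c → c ℕ.< N → ∑ (upTo N) (λ i → [ i ℕ.≤? c ]· 1ℤ) ≡ + suc c
count-below N c c<N = trans (∑-congP (upTo N) (λ i → sym ([]·-holds (0 ℕ.≤? i) z≤n ([ i ℕ.≤? c ]· 1ℤ))))
                             (trans (∑-congP (upTo N) (λ i → sym ([]·-× (0 ℕ.≤? i) (i ℕ.≤? c) 1ℤ))) (count-window-< N 0 c c<N))

window⇒ : ∀ {i j K r} → j ℕ.≤ i → r ℕ.≤ K → + i - + j ℤ.≤ + K - + r → i ℕ.≤ j ℕ.+ (K ∸ r)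
window⇒ {i} {j} {K} {r} j≤i r≤K le =
  subst (ℕ._≤ j ℕ.+ (K ∸ r)) (ℕ.m+[n∸m]≡n j≤i) (ℕ.+-monoʳ-≤ j (ℤ.drop‿+≤+ (subst₂ ℤ._≤_ (pos-∸ j≤i) (pos-∸ r≤K) le)))

window⇐ : ∀ {i j K r} → j ℕ.≤ i → r ℕ.≤ K → i ℕ.≤ j ℕ.+ (K ∸ r) → + i - + j ℤ.≤ + K - + r
window⇐ {i} {j} {K} {r} j≤i r≤K le = subst₂ ℤ._≤_ (sym (pos-∸ j≤i)) (sym (pos-∸ r≤K)) (ℤ.+≤+ (ℕ.m≤n+o⇒m∸n≤o i j le))

-- The right-hand side: counting ranks

signPred-σ : ∀ r → signPred r * + (r !) ≡ - σ r
signPred-σ zero = refl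
signPred-σ (suc r) = flip-sign (-1ℤ ^ r) (+ (suc r !))
  where
  flip-sign : ∀ s f → s * f ≡ - ((-1ℤ * s) * f)
  flip-sign = solve-∀

alternating-rank-sum : (P : FinitePoset) (b : FinitePoset.Carrier P) (rk : FinitePoset.Carrier P → ℕ) (n : ℕ) →
  rk b ≡ 0 → (∀ p → rk p ℕ.≤ n) →
  sumℤ (map (λ r → signPred r * (+ W P rk r) * (+ (r !))) (upTo (suc n)))
  ≡ - (1ℤ + ∑ (FinitePoset.elems P) (λ p → [ ¬? (FinitePoset._≟_ P p b) ]· σ (rk p)))
alternating-rank-sum P b rk n rk-b rk≤n = begin
  ∑ (upTo (suc n)) (λ r → signPred r * + W P rk r * + (r !))
    ≡⟨ ∑-congP (upTo (suc n)) by-elements ⟩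
  ∑ (upTo (suc n)) (λ r → ∑ elems (λ p → [ rk p ℕ.≟ r ]· c r))
    ≡⟨ ∑-swap elems (upTo (suc n)) (λ p r → [ rk p ℕ.≟ r ]· c r) ⟨
  ∑ elems (λ p → ∑ (upTo (suc n)) (λ r → [ rk p ℕ.≟ r ]· c r))
    ≡⟨ ∑-congP elems (λ p → trans (∑-congP (upTo (suc n)) (λ r → []·-⇔ sym sym (rk p ℕ.≟ r) (r ℕ.≟ rk p) (c r)))
                                  (∑-delta ℕ._≟_ (upTo (suc n)) (Unique.upTo⁺ (suc n)) (∈-upTo⁺ (s≤s (rk≤n p))) c)) ⟩
  ∑ elems (λ p → c (rk p))
    ≡⟨ trans (∑-congP elems (λ p → signPred-σ (rk p))) (∑-neg elems (σ ∘ rk)) ⟩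
  - ∑ elems (σ ∘ rk)
    ≡⟨ cong -_ (∑-remove _≟_ elems unique (complete b) (σ ∘ rk)) ⟩
  - (σ (rk b) + ∑ elems (λ p → [ ¬? (p ≟ b) ]· σ (rk p)))
    ≡⟨ cong (λ r → - (σ r + ∑ elems (λ p → [ ¬? (p ≟ b) ]· σ (rk p)))) rk-b ⟩
  - (1ℤ + ∑ elems (λ p → [ ¬? (p ≟ b) ]· σ (rk p)))
    ∎
  where
  open ≡-Reasoning
  open FinitePoset P
  c : ℕ → ℤ
  c r = signPred r * + (r !)
  by-elements : ∀ r → signPred r * + W P rk r * + (r !) ≡ ∑ elems (λ p → [ rk p ℕ.≟ r ]· c r)
  by-elements r = begin
    signPred r * + W P rk r * + (r !)              ≡⟨ commute (signPred r) (+ W P rk r) (+ (r !)) ⟩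
    + W P rk r * c r                               ≡⟨ cong (_* c r) (trans (length-∑ (filter (λ p → rk p ℕ.≟ r) elems)) (∑-filter (λ p → rk p ℕ.≟ r) elems (λ _ → 1ℤ))) ⟩
    ∑ elems (λ p → [ rk p ℕ.≟ r ]· 1ℤ) * c r       ≡⟨ ∑-*ʳ elems _ (c r) ⟨
    ∑ elems (λ p → ([ rk p ℕ.≟ r ]· 1ℤ) * c r)     ≡⟨ ∑-congP elems (λ p → []·-as-* (rk p ℕ.≟ r) (c r)) ⟨
    ∑ elems (λ p → [ rk p ℕ.≟ r ]· c r)            ∎
    where
    commute : ∀ s w f → s * w * f ≡ w * (s * f)
    commute = solve-∀

-- The Rees product P⁻ ∗ C_n and its Möbius function

module ReesProduct (P : FinitePoset) (b : FinitePoset.Carrier P) (simplicial : IsSimplicial P b)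
                   (rk : FinitePoset.Carrier P → ℕ) (rank : IsRankFunction P b rk)
                   (n : ℕ) (length-n : HasLength P rk n) where
  open FinitePoset P
  open SimplicialRanks P b simplicial rk rank

  R : List (Carrier × ℕ)
  R = ReesElems P b rk n

  _≺?_ : (x y : Carrier × ℕ) → Dec (ReesLt P rk x y)
  _≺?_ = ReesLt? P rk

  ρ : Carrier → ℕ
  ρ = rkMinus P rk

  ρ<n : ∀ {p} → 1 ℕ.≤ rk p → ρ p ℕ.< n
  ρ<n {p} rk-pos = ℕ.≤-trans (ℕ.≤-reflexive (ℕ.m+[n∸m]≡n rk-pos)) (proj₁ length-n p)

  ∑fibre : Carrier → (Carrier × ℕ → ℤ) → ℤ
  ∑fibre p h = ∑ (upTo n) (λ i → [ i ℕ.≤? ρ p ]· h (p , i))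

  ∑-Rees : ∀ h → ∑ R h ≡ ∑ elems (λ p → [ ¬? (p ≟ b) ]· ∑fibre p h)
  ∑-Rees h = begin
    ∑ R h
      ≡⟨ ∑-filter _ pairs h ⟩
    ∑ pairs (λ x → [ ¬? (proj₁ x ≟ b) ×-dec proj₂ x ℕ.≤? ρ (proj₁ x) ]· h x)
      ≡⟨ ∑-concatMap (λ p → map (p ,_) (upTo n)) elems _ ⟩
    ∑ elems (λ p → ∑ (map (p ,_) (upTo n)) (λ x → [ ¬? (proj₁ x ≟ b) ×-dec proj₂ x ℕ.≤? ρ (proj₁ x) ]· h x))
      ≡⟨ ∑-congP elems (λ p → trans (∑-map (p ,_) (upTo n) _)
           (trans (∑-congP (upTo n) (λ i → []·-× (¬? (p ≟ b)) (i ℕ.≤? ρ p) _)) (∑-[]· (upTo n) (¬? (p ≟ b)) _))) ⟩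
    ∑ elems (λ p → [ ¬? (p ≟ b) ]· ∑fibre p h)
      ∎
    where
    open ≡-Reasoning
    pairs : List (Carrier × ℕ)
    pairs = concatMap (λ p → map (p ,_) (upTo n)) elems

  fibre-size : ∀ {p} → ¬ p ≡ b → ∑fibre p (λ _ → 1ℤ) ≡ + rk p
  fibre-size {p} p≢b = trans (count-below n (ρ p) (ρ<n (rank-pos p≢b))) (cong +_ (ℕ.m+[n∸m]≡n (rank-pos p≢b)))

  μ : ℕ → Carrier × ℕ → ℤ
  μ = mobFrom0 R _≺?_

  μ-suc : ∀ k x → μ (suc k) x ≡ - (1ℤ + ∑ R (λ z → [ z ≺? x ]· μ k z))
  μ-suc k x = cong (λ t → - (1ℤ + t)) (∑-filter (_≺? x) R (μ k))

  -- w p q: for q < p, the number of elements of the fibre of p above a fixed element of the fibre of q.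
  w : Carrier → Carrier → ℤ
  w p q = [ q ≤? p ×-dec ¬? (q ≟ p) ]· (+ rk p - + rk q + 1ℤ)

  private
    weight-value : ∀ {x y} → 1 ℕ.≤ y → y ℕ.≤ x → + suc ((x ∸ 1) ∸ (y ∸ 1)) ≡ + x - + y + 1ℤ
    weight-value {x} {suc y} _ y<x = begin
      + suc ((x ∸ 1) ∸ y)    ≡⟨ cong (λ d → + suc d) (ℕ.∸-+-assoc x 1 y) ⟩
      + suc (x ∸ suc y)      ≡⟨ trans (cong +_ (ℕ.+-comm 1 (x ∸ suc y))) (ℤ.pos-+ (x ∸ suc y) 1) ⟩
      + (x ∸ suc y) + 1ℤ     ≡⟨ cong (_+ 1ℤ) (pos-∸ y<x) ⟨
      + x - + suc y + 1ℤ     ∎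
      where open ≡-Reasoning

  rees-count : ∀ p q j → ¬ q ≡ b → j ℕ.≤ ρ q →
    ∑ (upTo n) (λ i → [ i ℕ.≤? ρ p ×-dec (q , j) ≺? (p , i) ]· 1ℤ) ≡ w p q
  rees-count p q j q≢b j≤ρq = count (q ≤? p) (q ≟ p)
    where
    open ≡-Reasoning
    LHS : ℤ
    LHS = ∑ (upTo n) (λ i → [ i ℕ.≤? ρ p ×-dec (q , j) ≺? (p , i) ]· 1ℤ)
    none : (∀ i → ¬ ReesLt P rk (q , j) (p , i)) → LHS ≡ 0ℤ
    none ⊀ = ∑-zero (upTo n) (λ {i} _ → []·-fails (i ℕ.≤? ρ p ×-dec (q , j) ≺? (p , i)) (⊀ i ∘ proj₂) 1ℤ)
    count : (q≤p? : Dec (q ≤ p)) (q≡p? : Dec (q ≡ p)) → LHS ≡ ([ q≤p? ×-dec ¬? q≡p? ]· (+ rk p - + rk q + 1ℤ))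
    count (no q≰p) _ = none (λ i ≺ → q≰p (proj₁ (proj₁ ≺)))
    count (yes q≤p) (yes refl) = none (λ i ((_ , j≤i , i-j≤0) , ≢) →
      ≢ (cong (q ,_) (ℕ.≤-antisym j≤i (subst (i ℕ.≤_) (trans (cong (j ℕ.+_) (ℕ.n∸n≡0 (ρ q))) (ℕ.+-identityʳ j)) (window⇒ {K = ρ q} j≤i ℕ.≤-refl i-j≤0)))))
    count (yes q≤p) (no q≢p) = begin
      LHS                                                           ≡⟨ ∑-congP (upTo n) (λ i → []·-⇔ (to i) (from i) _ _ 1ℤ) ⟩
      ∑ (upTo n) (λ i → [ j ℕ.≤? i ×-dec i ℕ.≤? j ℕ.+ d ]· 1ℤ)     ≡⟨ count-window-< n j (j ℕ.+ d) (ℕ.≤-<-trans c≤ρp (ρ<n rk-p-pos)) ⟩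
      + (suc (j ℕ.+ d) ∸ j)                                         ≡⟨ cong +_ (trans (ℕ.+-∸-assoc 1 (ℕ.m≤m+n j d)) (cong suc (ℕ.m+n∸m≡n j d))) ⟩
      + suc d                                                       ≡⟨ weight-value (rank-pos q≢b) (ℕ.<⇒≤ q<p) ⟩
      + rk p - + rk q + 1ℤ                                          ∎
      where
      q<p : rk q ℕ.< rk p
      q<p = rank-strict q≤p q≢p
      rk-p-pos : 1 ℕ.≤ rk p
      rk-p-pos = ℕ.≤-trans (rank-pos q≢b) (ℕ.<⇒≤ q<p)
      ρq≤ρp : ρ q ℕ.≤ ρ p
      ρq≤ρp = ℕ.∸-monoˡ-≤ 1 (ℕ.<⇒≤ q<p)
      d : ℕ
      d = ρ p ∸ ρ q
      c≤ρp : j ℕ.+ d ℕ.≤ ρ p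
      c≤ρp = ℕ.≤-trans (ℕ.+-monoˡ-≤ d j≤ρq) (ℕ.≤-reflexive (ℕ.m+[n∸m]≡n ρq≤ρp))
      to : ∀ i → i ℕ.≤ ρ p × ReesLt P rk (q , j) (p , i) → j ℕ.≤ i × i ℕ.≤ j ℕ.+ d
      to i (_ , (_ , j≤i , le) , _) = j≤i , window⇒ j≤i ρq≤ρp le
      from : ∀ i → j ℕ.≤ i × i ℕ.≤ j ℕ.+ d → i ℕ.≤ ρ p × ReesLt P rk (q , j) (p , i)
      from i (j≤i , i≤c) = ℕ.≤-trans i≤c c≤ρp , (q≤p , j≤i , window⇐ j≤i ρq≤ρp i≤c) , q≢p ∘ cong proj₁

  ∑-below-fibre : ∀ p (g : Carrier × ℕ → ℤ) →
    ∑ (upTo n) (λ i → [ i ℕ.≤? ρ p ]· ∑ R (λ z → [ z ≺? (p , i) ]· g z))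
    ≡ ∑ elems (λ q → [ ¬? (q ≟ b) ]· (w p q * ∑fibre q g))
  ∑-below-fibre p g = begin
    ∑ (upTo n) (λ i → [ i ℕ.≤? ρ p ]· ∑ R (λ z → [ z ≺? (p , i) ]· g z))
      ≡⟨ ∑-congP (upTo n) (λ i → trans (sym (∑-[]· R (i ℕ.≤? ρ p) _))
           (∑-congP R (λ z → trans (sym ([]·-× (i ℕ.≤? ρ p) (z ≺? (p , i)) (g z))) ([]·-as-* _ (g z))))) ⟩
    ∑ (upTo n) (λ i → ∑ R (λ z → ([ i ℕ.≤? ρ p ×-dec z ≺? (p , i) ]· 1ℤ) * g z))
      ≡⟨ ∑-swap (upTo n) R _ ⟩
    ∑ R (λ z → ∑ (upTo n) (λ i → ([ i ℕ.≤? ρ p ×-dec z ≺? (p , i) ]· 1ℤ) * g z))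
      ≡⟨ ∑-congP R (λ z → ∑-*ʳ (upTo n) _ (g z)) ⟩
    ∑ R (λ z → count z * g z)
      ≡⟨ ∑-Rees (λ z → count z * g z) ⟩
    ∑ elems (λ q → [ ¬? (q ≟ b) ]· ∑fibre q (λ z → count z * g z))
      ≡⟨ ∑-congP elems (λ q → []·-cong (¬? (q ≟ b)) (λ q≢b → weigh q q≢b)) ⟩
    ∑ elems (λ q → [ ¬? (q ≟ b) ]· (w p q * ∑fibre q g))
      ∎
    where
    open ≡-Reasoning
    count : Carrier × ℕ → ℤ
    count z = ∑ (upTo n) (λ i → [ i ℕ.≤? ρ p ×-dec z ≺? (p , i) ]· 1ℤ)
    weigh : ∀ q → ¬ q ≡ b → ∑fibre q (λ z → count z * g z) ≡ w p q * ∑fibre q g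
    weigh q q≢b = trans (∑-congP (upTo n) (λ j → trans ([]·-cong (j ℕ.≤? ρ q) (λ j≤ρq → cong (_* g (q , j)) (rees-count p q j q≢b j≤ρq)))
                                                        ([]·-*ˡ (j ℕ.≤? ρ q) (w p q) (g (q , j)))))
                        (∑-*ˡ (upTo n) (w p q) _)

  fibre-recursion : ∀ k p → ¬ p ≡ b →
    ∑fibre p (μ (suc k)) ≡ - + rk p - ∑ elems (λ q → [ ¬? (q ≟ b) ]· (w p q * ∑fibre q (μ k)))
  fibre-recursion k p p≢b = begin
    ∑fibre p (μ (suc k))
      ≡⟨ ∑-congP (upTo n) (λ i → trans (cong ([ i ℕ.≤? ρ p ]·_) (μ-suc k (p , i))) (negate (i ℕ.≤? ρ p) _)) ⟩
    ∑ (upTo n) (λ i → - ([ i ℕ.≤? ρ p ]· 1ℤ) + - ([ i ℕ.≤? ρ p ]· X i))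
      ≡⟨ trans (∑-+ (upTo n) _ _) (cong₂ _+_ (∑-neg (upTo n) _) (∑-neg (upTo n) _)) ⟩
    - ∑fibre p (λ _ → 1ℤ) - ∑ (upTo n) (λ i → [ i ℕ.≤? ρ p ]· X i)
      ≡⟨ cong₂ (λ a c → - a - c) (fibre-size p≢b) (∑-below-fibre p (μ k)) ⟩
    - + rk p - ∑ elems (λ q → [ ¬? (q ≟ b) ]· (w p q * ∑fibre q (μ k)))
      ∎
    where
    open ≡-Reasoning
    X : ℕ → ℤ
    X i = ∑ R (λ z → [ z ≺? (p , i) ]· μ k z)
    negate : ∀ {A : Set} (d : Dec A) x → ([ d ]· - (1ℤ + x)) ≡ - ([ d ]· 1ℤ) + - ([ d ]· x)
    negate (yes _) x = ℤ.neg-distrib-+ 1ℤ x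
    negate (no _) x = refl

  split-below : ∀ p q → ¬ p ≡ b → (q≤p? : Dec (q ≤ p)) (q≡b? : Dec (q ≡ b)) (q≡p? : Dec (q ≡ p)) (v s : ℤ) →
    ([ q≤p? ]· (v * s)) ≡ ([ q≡b? ]· (v * s)) + ([ q≡p? ]· (v * s)) + ([ ¬? q≡b? ]· (([ q≤p? ×-dec ¬? q≡p? ]· v) * s))
  split-below p q p≢b _ (yes q≡b) (yes q≡p) v s = ⊥-elim (p≢b (trans (sym q≡p) q≡b))
  split-below p q p≢b (yes _) (yes _) (no _) v s = sym (trans (ℤ.+-identityʳ _) (ℤ.+-identityʳ (v * s)))
  split-below p q p≢b (no q≰p) (yes refl) _ v s = ⊥-elim (q≰p (b-min p))
  split-below p q p≢b (yes _) (no _) (yes _) v s = sym (trans (ℤ.+-identityʳ _) (ℤ.+-identityˡ (v * s)))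
  split-below p q p≢b (no q≰p) (no _) (yes refl) v s = ⊥-elim (q≰p (≤-refl q))
  split-below p q p≢b (yes _) (no _) (no _) v s = sym (ℤ.+-identityˡ (v * s))
  split-below p q p≢b (no _) (no _) (no _) v s = refl

  open-interval-identity : ∀ p → ¬ p ≡ b → ∑ elems (λ q → [ ¬? (q ≟ b) ]· (w p q * σ (rk q))) ≡ - + rk p - σ (rk p)
  open-interval-identity p p≢b = begin
    Inner                                          ≡⟨ isolate (H b) (H p) Inner ⟩
    (H b + H p + Inner) - H b - H p                ≡⟨ cong (λ t → t - H b - H p) whole ⟩
    1ℤ - H b - H p                                 ≡⟨ cong (λ r → 1ℤ - (+ rk p - + r + 1ℤ) * σ r - H p) (proj₁ rank) ⟩
    1ℤ - (+ rk p - 0ℤ + 1ℤ) * 1ℤ - H p            ≡⟨ evaluate (+ rk p) (σ (rk p)) ⟩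
    - + rk p - σ (rk p)                            ∎
    where
    open ≡-Reasoning
    H : Carrier → ℤ
    H q = (+ rk p - + rk q + 1ℤ) * σ (rk q)
    Inner : ℤ
    Inner = ∑ elems (λ q → [ ¬? (q ≟ b) ]· (w p q * σ (rk q)))
    isolate : ∀ x y z → z ≡ (x + y + z) - x - y
    isolate = solve-∀
    evaluate : ∀ K s → 1ℤ - (K - 0ℤ + 1ℤ) * 1ℤ - (K - K + 1ℤ) * s ≡ - K - s
    evaluate = solve-∀
    whole : H b + H p + Inner ≡ 1ℤ
    whole = begin
      H b + H p + Inner
        ≡⟨ cong₂ (λ x y → x + y + Inner) (∑-delta _≟_ elems unique (complete b) H) (∑-delta _≟_ elems unique (complete p) H) ⟨
      ∑ elems (λ q → [ q ≟ b ]· H q) + ∑ elems (λ q → [ q ≟ p ]· H q) + Inner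
        ≡⟨ trans (cong (_+ Inner) (sym (∑-+ elems _ _))) (sym (∑-+ elems _ _)) ⟩
      ∑ elems (λ q → ([ q ≟ b ]· H q) + ([ q ≟ p ]· H q) + ([ ¬? (q ≟ b) ]· (w p q * σ (rk q))))
        ≡⟨ ∑-congP elems (λ q → split-below p q p≢b (q ≤? p) (q ≟ b) (q ≟ p) _ (σ (rk q))) ⟨
      ∑ elems (λ q → [ q ≤? p ]· H q)
        ≡⟨ interval-identity p ⟩
      1ℤ
        ∎

  -- Main computation: the fibre sums of the Möbius function are σ(rk p), once the
  -- recursion depth k reaches rk p (induction on k, using that q < p lowers the rank).
  fibre-value : ∀ k p → ¬ p ≡ b → rk p ℕ.≤ k → ∑fibre p (μ k) ≡ σ (rk p)
  fibre-value zero p p≢b rk≤0 = ⊥-elim (ℕ.<-irrefl refl (ℕ.<-≤-trans (rank-pos p≢b) rk≤0))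
  fibre-value (suc k) p p≢b rk≤1+k = begin
    ∑fibre p (μ (suc k))                                                   ≡⟨ fibre-recursion k p p≢b ⟩
    - + rk p - ∑ elems (λ q → [ ¬? (q ≟ b) ]· (w p q * ∑fibre q (μ k)))   ≡⟨ cong (λ t → - + rk p - t) (∑-congP elems below) ⟩
    - + rk p - ∑ elems (λ q → [ ¬? (q ≟ b) ]· (w p q * σ (rk q)))          ≡⟨ cong (λ t → - + rk p - t) (open-interval-identity p p≢b) ⟩
    - + rk p - (- + rk p - σ (rk p))                                       ≡⟨ cancel (+ rk p) (σ (rk p)) ⟩
    σ (rk p)                                                               ∎
    where
    open ≡-Reasoning
    cancel : ∀ K s → - K - (- K - s) ≡ s
    cancel = solve-∀
    below : ∀ q → ([ ¬? (q ≟ b) ]· (w p q * ∑fibre q (μ k))) ≡ ([ ¬? (q ≟ b) ]· (w p q * σ (rk q)))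
    below q = []·-cong (¬? (q ≟ b)) (λ q≢b → induction q≢b (q ≤? p ×-dec ¬? (q ≟ p)))
      where
      induction : ¬ q ≡ b → (q<p? : Dec (q ≤ p × ¬ q ≡ p)) → let v = + rk p - + rk q + 1ℤ in
        ([ q<p? ]· v) * ∑fibre q (μ k) ≡ ([ q<p? ]· v) * σ (rk q)
      induction q≢b (yes (q≤p , q≢p)) =
        cong (λ t → (+ rk p - + rk q + 1ℤ) * t) (fibre-value k q q≢b (ℕ.≤-pred (ℕ.<-≤-trans (rank-strict q≤p q≢p) rk≤1+k)))
      induction q≢b (no _) = refl

  rank≤size : ∀ p → ¬ p ≡ b → rk p ℕ.≤ length R
  rank≤size p p≢b = ℤ.drop‿+≤+ (begin
    + rk p                                        ≡⟨ []·-holds (¬? (p ≟ b)) p≢b (+ rk p) ⟨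
    ([ ¬? (p ≟ b) ]· + rk p)                     ≤⟨ ∑-≥-term elems _ nonneg (complete p) ⟩
    ∑ elems (λ q → [ ¬? (q ≟ b) ]· + rk q)       ≡⟨ ∑-congP elems (λ q → []·-cong (¬? (q ≟ b)) fibre-size) ⟨
    ∑ elems (λ q → [ ¬? (q ≟ b) ]· ∑fibre q (λ _ → 1ℤ)) ≡⟨ ∑-Rees (λ _ → 1ℤ) ⟨
    ∑ R (λ _ → 1ℤ)                               ≡⟨ length-∑ R ⟨
    + length R                                    ∎)
    where
    open ℤ.≤-Reasoning
    nonneg : ∀ q → 0ℤ ℤ.≤ ([ ¬? (q ≟ b) ]· + rk q)
    nonneg q with ¬? (q ≟ b)
    ... | yes _ = ℤ.+≤+ z≤n
    ... | no _ = ℤ.≤-refl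

  mobius-Rees : mobiusHat R _≺?_ ≡ - (1ℤ + ∑ elems (λ p → [ ¬? (p ≟ b) ]· σ (rk p)))
  mobius-Rees = cong (λ t → - (1ℤ + t)) (trans (∑-Rees (μ (length R)))
    (∑-congP elems (λ p → []·-cong (¬? (p ≟ b)) (λ p≢b → fibre-value (length R) p p≢b (rank≤size p p≢b)))))

corollary6p1 : (P : FinitePoset) (b : FinitePoset.Carrier P)
    → IsSimplicial P b
    → (rk : FinitePoset.Carrier P → ℕ) → IsRankFunction P b rk
    → (n : ℕ) → HasLength P rk n
    → mobiusHat (ReesElems P b rk n) (ReesLt? P rk)
      ≡ sumℤ (map (λ r → signPred r * (+ W P rk r) * (+ (r !))) (upTo (suc n)))
corollary6p1 P b simplicial rk rank n length-n =
  trans (ReesProduct.mobius-Rees P b simplicial rk rank n length-n)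
        (sym (alternating-rank-sum P b rk n (proj₁ rank) (proj₁ length-n)))
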